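{- Let $T$ be a mixed tree of order $n$ and size $m$ and let $a,b\in V(T)$ be distinct with $\vec{ab}\notin E(T)$ and $\vec{ba}\notin E(T)$. Then $T_b^a$ is a mixed tree (of order $n$ and size $m$) if and only if either $ab\in E(T)$, or $\partial(a,b)=2$ and the unique vertex $x$ with $\partial(a,x)=\partial(x,b)=1$ satisfies one of: (i) $ax$ is an undirected edge; (ii) $xb$ is an undirected edge; (iii) $\vec{ax},\vec{bx}\in E(T)$ are arcs; (iv) $\vec{xa},\vec{xb}\in E(T)$ are arcs.
   Context: Mixed graph on $[n]$: between two distinct vertices at most one of an arc $\vec{ij}$, an undirected edge $ij$, or nothing; adjacency matrix $a_{ij}=1$ iff $\vec{ij}$ or $ij\in E$; size = number of arcs plus twice the number of undirected edges. The underlying graph forgets arc directions; $\partial(a,b)$ is the distance in the underlying graph; a mixed tree is a mixed graph whose underlying graph is a tree. For distinct $a,b$ with no arc between them, the Kelmans transformation $T_b^a$ is the mixed graph with adjacency matrix $A'$ where for $i\notin\{a,b\}$, $a'_{ia}=\max(a_{ia},a_{ib})$, $a'_{ib}=\min(a_{ia},a_{ib})$, $a'_{ai}=\max(a_{ai},a_{bi})$, $a'_{bi}=\min(a_{ai},a_{bi})$, and all other entries unchanged. -}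

module Defs where

open import Data.Bool using (Bool; true; false; _∧_; _∨_; not; if_then_else_)
open import Data.Nat using (ℕ; _≤_)
open import Data.Fin using (Fin)
open import Data.Fin.Properties using (_≟_)
open import Data.List using (List; []; _∷_; _++_; [_]; length; map; allFin)
open import Data.Nat.ListAction using (sum)
open import Data.List.Relation.Unary.Unique.Propositional using (Unique)
open import Data.List.Relation.Unary.Linked using (Linked)
open import Data.Product using (Σ; _×_)
open import Data.Sum using (_⊎_)
open import Relation.Nullary using (¬_)
open import Relation.Nullary.Decidable using (⌊_⌋)
open import Relation.Binary.PropositionalEquality using (_≡_; refl)

-- A mixed graph on [n] = Fin n is determined by its 0/1 adjacency matrix
-- with zero diagonal: a_ij = a_ji = 1 is an undirected edge ij,
-- a_ij = 1, a_ji = 0 is an arc i→j, a_ij = a_ji = 0 is nothing.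
record MixedGraph (n : ℕ) : Set where
  field
    adj      : Fin n → Fin n → Bool
    loopless : ∀ i → adj i i ≡ false
open MixedGraph public

module _ {n : ℕ} (G : MixedGraph n) where

  Arc : Fin n → Fin n → Set
  Arc i j = (adj G i j ≡ true) × (adj G j i ≡ false)

  Edge : Fin n → Fin n → Set
  Edge i j = (adj G i j ≡ true) × (adj G j i ≡ true)

  -- adjacency in the underlying graph (arc directions forgotten);
  -- i.e. ∂(i,j) = 1
  UAdj : Fin n → Fin n → Set
  UAdj i j = (adj G i j ≡ true) ⊎ (adj G j i ≡ true)

  -- size = number of arcs + 2 * number of undirected edges
  --      = number of ones in the adjacency matrix
  size : ℕ
  size = sum (map (λ i → sum (map (λ j → if adj G i j then 1 else 0) (allFin n))) (allFin n))

  data Reach : Fin n → Fin n → Set where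
    here : ∀ {i} → Reach i i
    step : ∀ {i j k} → UAdj i j → Reach j k → Reach i k

  Connected : Set
  Connected = ∀ i j → Reach i j

  IsCycle : Fin n → List (Fin n) → Set
  IsCycle v ws = (2 ≤ length ws) × Unique (v ∷ ws) × Linked UAdj (v ∷ ws ++ [ v ])

  Acyclic : Set
  Acyclic = ¬ (Σ (Fin n) λ v → Σ (List (Fin n)) λ ws → IsCycle v ws)

  IsMixedTree : Set
  IsMixedTree = Connected × Acyclic

private
  sel : ∀ {n} → (Fin n → Fin n → Bool) → Fin n → Fin n → Fin n → Fin n →
        Bool → Bool → Bool → Bool → Bool
  sel A a b i j ia ib ja jb =
    if ja ∧ not ia ∧ not ib then A i a ∨ A i b
    else if jb ∧ not ia ∧ not ib then A i a ∧ A i b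
    else if ia ∧ not ja ∧ not jb then A a j ∨ A b j
    else if ib ∧ not ja ∧ not jb then A a j ∧ A b j
    else A i j

  kadj : ∀ {n} → (Fin n → Fin n → Bool) → Fin n → Fin n → Fin n → Fin n → Bool
  kadj A a b i j = sel A a b i j ⌊ i ≟ a ⌋ ⌊ i ≟ b ⌋ ⌊ j ≟ a ⌋ ⌊ j ≟ b ⌋

  sel-diag : ∀ {n} (A : Fin n → Fin n → Bool) a b i → A i i ≡ false →
             ∀ p q → sel A a b i i p q p q ≡ false
  sel-diag A a b i h false false = h
  sel-diag A a b i h false true = h
  sel-diag A a b i h true false = h
  sel-diag A a b i h true true = h

kelmans : ∀ {n} → MixedGraph n → Fin n → Fin n → MixedGraph n
kelmans G a b = record
  { adj = kadj (adj G) a b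
  ; loopless = λ i → sel-diag (adj G) a b i (loopless G i) ⌊ i ≟ a ⌋ ⌊ i ≟ b ⌋
  }

{-# OPTIONS --safe #-}
-- For every vertex i ∉ {a, b} the Kelmans operation replaces the pair of entries
-- (A i a, A i b) by (A i a ∨ A i b, A i a ∧ A i b), and likewise the pair (A a i, A b i);
-- ∨ and ∧ together keep the number of ones, so the size is unchanged.  In T_b^a the
-- neighbours of b other than a are exactly the common neighbours of a and b joined to
-- both with the same orientation, so if T_b^a is connected then b has such a neighbour
-- or is adjacent to a, which gives the criterion.  Conversely, under the criterion a and
-- b stay joined in T_b^a (directly or through x), so T_b^a is connected, and b is a leaf
-- of T_b^a: a second such neighbour, or one together with the edge ab, would close a
-- cycle of T.  A cycle of T_b^a thus avoids b; if it also avoids a it is a cycle of T,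
-- and otherwise its two edges at a come from edges of T at a or b and the cycle can be
-- rerouted through b (and x) into a cycle of T.

module Submission where

open import Defs
open import Data.Bool using (Bool; true; false; _∧_; _∨_; if_then_else_)
open import Data.Empty using (⊥; ⊥-elim)
open import Data.Fin using (Fin; zero; suc; punchIn)
open import Data.Fin.Properties using (_≟_; punchInᵢ≢i)
open import Data.List using (List; []; _∷_; _++_; [_]; length; map; allFin; tabulate)
open import Data.List.Properties using (map-tabulate; ++-assoc; length-++)
open import Data.List.Membership.Propositional using (_∈_; _∉_)
open import Data.List.Membership.Propositional.Properties using (∈-++⁺ˡ; ∈-++⁺ʳ; ∈-++⁻; ∈-∃++)
import Data.List.Membership.DecPropositional as DecMembership
open import Data.List.Relation.Binary.Disjoint.Propositional using (Disjoint)
open import Data.List.Relation.Unary.All as All using (All; []; _∷_)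
import Data.List.Relation.Unary.All.Properties as Allₚ
open import Data.List.Relation.Unary.AllPairs using ([]; _∷_)
open import Data.List.Relation.Unary.Any using (here; there)
open import Data.List.Relation.Unary.Linked using (Linked; []; [-]; _∷_)
open import Data.List.Relation.Unary.Unique.Propositional using (Unique)
import Data.List.Relation.Unary.Unique.Propositional.Properties as Unique
open import Data.Nat using (ℕ; zero; suc; _+_; _≤_; s≤s; z≤n)
import Data.Nat.ListAction as List
open import Data.Nat.Properties using (+-0-commutativeMonoid; +-assoc; +-comm; +-suc; +-cancelʳ-≡)
open import Data.Nat.Tactic.RingSolver using (solve-∀)
open import Algebra.Properties.CommutativeMonoid.Sum +-0-commutativeMonoid
  using (sum-remove; sum-cong-≗; ∑-distrib-+) renaming (sum to ∑)
open import Data.Product using (Σ; ∃₂; _×_; _,_; proj₁; proj₂)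
open import Data.Sum using (_⊎_; inj₁; inj₂)
open import Data.Vec.Functional using (removeAt; updateAt)
open import Data.Vec.Functional.Properties using (updateAt-updates; updateAt-minimal)
open import Function using (id; const; _∘_)
open import Function.Bundles using (_⇔_; mk⇔; Equivalence)
open import Relation.Binary.PropositionalEquality
  using (_≡_; _≢_; refl; sym; trans; cong; cong₂; subst; subst₂; module ≡-Reasoning)
open import Relation.Nullary using (¬_; Dec; yes; no; contradiction)
open import Relation.Nullary.Decidable using (isYes; isYes≗does; dec-true; dec-false)

∨≡true⁻ : ∀ {x y} → x ∨ y ≡ true → x ≡ true ⊎ y ≡ true
∨≡true⁻ {true}  _ = inj₁ refl
∨≡true⁻ {false} e = inj₂ e

∨≡true⁺ : ∀ {x y} → x ≡ true ⊎ y ≡ true → x ∨ y ≡ true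
∨≡true⁺ {true}  _         = refl
∨≡true⁺ {false} (inj₂ e) = e

∧≡true⁻ : ∀ {x y} → x ∧ y ≡ true → x ≡ true × y ≡ true
∧≡true⁻ {true} {true} _ = refl , refl

∧≡true⁺ : ∀ {x y} → x ≡ true → y ≡ true → x ∧ y ≡ true
∧≡true⁺ refl refl = refl

ones : Bool → ℕ
ones b = if b then 1 else 0

ones-∨-∧ : ∀ x y → ones (x ∨ y) + ones (x ∧ y) ≡ ones x + ones y
ones-∨-∧ true  true  = refl
ones-∨-∧ true  false = refl
ones-∨-∧ false true  = refl
ones-∨-∧ false false = refl

isYes-true : ∀ {p} {P : Set p} (P? : Dec P) → P → isYes P? ≡ true
isYes-true P? p = trans (isYes≗does P?) (dec-true P? p)

isYes-false : ∀ {p} {P : Set p} (P? : Dec P) → ¬ P → isYes P? ≡ false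
isYes-false P? ¬p = trans (isYes≗does P?) (dec-false P? ¬p)

sum-map-allFin : ∀ {n} (f : Fin n → ℕ) → List.sum (map f (allFin n)) ≡ ∑ f
sum-map-allFin {n} f = trans (cong List.sum (map-tabulate id f)) (sum-tabulate f)
  where
  sum-tabulate : ∀ {m} (g : Fin m → ℕ) → List.sum (tabulate g) ≡ ∑ g
  sum-tabulate {zero}  g = refl
  sum-tabulate {suc m} g = cong (g zero +_) (sum-tabulate (g ∘ suc))

∑-agree-off₁ : ∀ {n} (f g : Fin n → ℕ) a → (∀ j → j ≢ a → f j ≡ g j) →
               ∑ f + g a ≡ ∑ g + f a
∑-agree-off₁ {suc n} f g a agree = begin
  ∑ f + g a                     ≡⟨ cong (_+ g a) (sum-remove f) ⟩
  f a + ∑ (removeAt f a) + g a  ≡⟨ cong (λ s → f a + s + g a) rest ⟩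
  f a + ∑ (removeAt g a) + g a  ≡⟨ swap (f a) (∑ (removeAt g a)) (g a) ⟩
  g a + ∑ (removeAt g a) + f a  ≡⟨ cong (_+ f a) (sym (sum-remove g)) ⟩
  ∑ g + f a                     ∎
  where
  open ≡-Reasoning
  rest : ∑ (removeAt f a) ≡ ∑ (removeAt g a)
  rest = sum-cong-≗ (λ j → agree (punchIn a j) (punchInᵢ≢i a j))
  swap : ∀ x s y → x + s + y ≡ y + s + x
  swap = solve-∀

∑-agree-off₂ : ∀ {n} (f g : Fin n → ℕ) {a b} → a ≢ b →
               (∀ j → j ≢ a → j ≢ b → f j ≡ g j) → f a + f b ≡ g a + g b → ∑ f ≡ ∑ g
∑-agree-off₂ f g {a} {b} a≢b agree fab≡gab = +-cancelʳ-≡ (f a + f b) (∑ f) (∑ g) (begin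
  ∑ f + (f a + f b)   ≡⟨ cong (∑ f +_) fab≡gab ⟩
  ∑ f + (g a + g b)   ≡⟨ sym (+-assoc (∑ f) (g a) (g b)) ⟩
  ∑ f + g a + g b     ≡⟨ cong (λ t → ∑ f + t + g b) (sym (updateAt-updates a f)) ⟩
  ∑ f + h a + g b     ≡⟨ cong (_+ g b) (∑-agree-off₁ f h a f≡h) ⟩
  ∑ h + f a + g b     ≡⟨ swap (∑ h) (f a) (g b) ⟩
  ∑ h + g b + f a     ≡⟨ cong (_+ f a) (∑-agree-off₁ h g b h≡g) ⟩
  ∑ g + h b + f a     ≡⟨ cong (λ t → ∑ g + t + f a) hb≡fb ⟩
  ∑ g + f b + f a     ≡⟨ +-assoc (∑ g) (f b) (f a) ⟩
  ∑ g + (f b + f a)   ≡⟨ cong (∑ g +_) (+-comm (f b) (f a)) ⟩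
  ∑ g + (f a + f b)   ∎)
  where
  open ≡-Reasoning
  h : Fin _ → ℕ
  h = updateAt f a (const (g a))
  f≡h : ∀ j → j ≢ a → f j ≡ h j
  f≡h j j≢a = sym (updateAt-minimal j a f j≢a)
  h≡g : ∀ j → j ≢ b → h j ≡ g j
  h≡g j j≢b with j ≟ a
  ... | yes refl = updateAt-updates a f
  ... | no j≢a   = trans (updateAt-minimal j a f j≢a) (agree j j≢a j≢b)
  hb≡fb : h b ≡ f b
  hb≡fb = updateAt-minimal b a f (a≢b ∘ sym)
  swap : ∀ s x y → s + x + y ≡ s + y + x
  swap = solve-∀

row-ones : ∀ {n} → (Fin n → Fin n → Bool) → Fin n → ℕ
row-ones M i = ∑ λ j → ones (M i j)

size≡∑row-ones : ∀ {n} (G : MixedGraph n) → size G ≡ ∑ (row-ones (adj G))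
size≡∑row-ones G = trans (sum-map-allFin (λ i → List.sum (map (ones ∘ adj G i) (allFin _))))
                         (sum-cong-≗ λ i → sum-map-allFin (ones ∘ adj G i))

module _ {A : Set} where

  ∈-∷ʳ⁻ : ∀ {z y : A} xs → z ∈ xs ++ [ y ] → z ∈ xs ⊎ z ≡ y
  ∈-∷ʳ⁻ xs z∈ with ∈-++⁻ xs z∈
  ... | inj₁ z∈xs        = inj₁ z∈xs
  ... | inj₂ (here z≡y) = inj₂ z≡y

  ∉-∷ʳ⁺ : ∀ {z y : A} xs → z ∉ xs → z ≢ y → z ∉ xs ++ [ y ]
  ∉-∷ʳ⁺ xs z∉xs z≢y z∈ with ∈-∷ʳ⁻ xs z∈
  ... | inj₁ z∈xs = z∉xs z∈xs
  ... | inj₂ z≡y  = z≢y z≡y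

  Unique-∷⁺ : ∀ {x : A} {xs} → x ∉ xs → Unique xs → Unique (x ∷ xs)
  Unique-∷⁺ {xs = xs} x∉xs u = Allₚ.¬Any⇒All¬ xs x∉xs ∷ u

  Unique-tail : ∀ {x : A} {xs} → Unique (x ∷ xs) → Unique xs
  Unique-tail (_ ∷ u) = u

  Unique-++⁻ : ∀ (xs : List A) {ys} → Unique (xs ++ ys) →
               Unique xs × Unique ys × Disjoint xs ys
  Unique-++⁻ []       u        = [] , u , λ ()
  Unique-++⁻ (x ∷ xs) (px ∷ u) with Unique-++⁻ xs u | Allₚ.++⁻ xs px
  ... | uxs , uys , disjoint | x∉xs , x∉ys =
    (x∉xs ∷ uxs) , uys , λ where
      (here refl , v∈ys) → Allₚ.All¬⇒¬Any x∉ys v∈ys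
      (there v∈xs , v∈ys) → disjoint (v∈xs , v∈ys)

  Unique-∷ʳ⁺ : ∀ {xs} {y : A} → Unique xs → y ∉ xs → Unique (xs ++ [ y ])
  Unique-∷ʳ⁺ u y∉xs = Unique.++⁺ u ([] ∷ []) λ { (v∈xs , here refl) → y∉xs v∈xs }

  length-∷-∷ʳ : ∀ (x : A) xs y → 2 ≤ length (x ∷ xs ++ [ y ])
  length-∷-∷ʳ x []      y = s≤s (s≤s z≤n)
  length-∷-∷ʳ x (_ ∷ _) y = s≤s (s≤s z≤n)

  length-rotate : ∀ (xs ys : List A) x y → length (xs ++ x ∷ ys) ≡ length (ys ++ y ∷ xs)
  length-rotate xs ys x y
    rewrite length-++ xs {x ∷ ys} | length-++ ys {y ∷ xs}
          | +-suc (length xs) (length ys) | +-suc (length ys) (length xs)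
          | +-comm (length xs) (length ys) = refl

module _ {A : Set} {R : A → A → Set} where

  Linked-split : ∀ xs y ys → Linked R (xs ++ y ∷ ys) → Linked R (xs ++ [ y ]) × Linked R (y ∷ ys)
  Linked-split []           y ys l       = [-] , l
  Linked-split (x ∷ [])     y ys (r ∷ l) = (r ∷ [-]) , l
  Linked-split (x ∷ x′ ∷ xs) y ys (r ∷ l) with Linked-split (x′ ∷ xs) y ys l
  ... | l₁ , l₂ = (r ∷ l₁) , l₂

  Linked-join : ∀ xs y ys → Linked R (xs ++ [ y ]) → Linked R (y ∷ ys) → Linked R (xs ++ y ∷ ys)
  Linked-join []           y ys _              l₂ = l₂
  Linked-join (x ∷ [])     y ys (r ∷ [-])      l₂ = r ∷ l₂
  Linked-join (x ∷ x′ ∷ xs) y ys (r ∷ l₁)       l₂ = r ∷ Linked-join (x′ ∷ xs) y ys l₁ l₂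

  Linked-mapᴾ : ∀ {S : A → A → Set} {P : A → Set} → (∀ {x y} → P x → P y → R x y → S x y) →
                ∀ {xs} → All P xs → Linked R xs → Linked S xs
  Linked-mapᴾ f []               []      = []
  Linked-mapᴾ f (_ ∷ [])         [-]     = [-]
  Linked-mapᴾ f (px ∷ py ∷ pxs) (r ∷ l) = f px py r ∷ Linked-mapᴾ f (py ∷ pxs) l

-- Path R x y ys: an R-walk from x to y whose vertices after x are ys.
data Path {A : Set} (R : A → A → Set) : A → A → List A → Set where
  end : ∀ {x} → Path R x x []
  _◅_ : ∀ {x y z ys} → R x y → Path R y z ys → Path R x z (y ∷ ys)

infixr 5 _◅_

module _ {A : Set} {R : A → A → Set} where

  infixl 5 _▻_
  _▻_ : ∀ {x y z ys} → Path R x y ys → R y z → Path R x z (ys ++ [ z ])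
  end     ▻ r = r ◅ end
  (q ◅ p) ▻ r = q ◅ (p ▻ r)

  Path⇒Linked : ∀ {x y ys} → Path R x y ys → Linked R (x ∷ ys)
  Path⇒Linked end           = [-]
  Path⇒Linked (r ◅ end)     = r ∷ [-]
  Path⇒Linked (r ◅ q ◅ p)   = r ∷ Path⇒Linked (q ◅ p)

  last∈ : ∀ {x y ys} → Path R x y ys → y ∈ x ∷ ys
  last∈ end     = here refl
  last∈ (r ◅ p) = there (last∈ p)

  Path-mapᴾ : ∀ {S : A → A → Set} {P : A → Set} → (∀ {x y} → P x → P y → R x y → S x y) →
              ∀ {x y ys} → All P (x ∷ ys) → Path R x y ys → Path S x y ys
  Path-mapᴾ f _                end     = end
  Path-mapᴾ f (px ∷ py ∷ pys) (r ◅ p) = f px py r ◅ Path-mapᴾ f (py ∷ pys) p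

  Linked-∷ʳ⇒Path : ∀ v w ws u → Linked R (v ∷ w ∷ ws ++ [ u ]) →
                   R v w × Σ A λ y → Path R w y ws × R y u
  Linked-∷ʳ⇒Path v w []        u (r ∷ r′ ∷ [-]) = r , w , end , r′
  Linked-∷ʳ⇒Path v w (w′ ∷ ws) u (r ∷ l) with Linked-∷ʳ⇒Path w w′ ws u l
  ... | r′ , y , p , r″ = r , y , r′ ◅ p , r″

  Path-split : ∀ {u w ys m} → Path R u w ys → m ∈ u ∷ ys →
               ∃₂ λ ps qs → Path R u m ps × Path R m w qs × ys ≡ ps ++ qs
  Path-split p       (here refl) = [] , _ , end , p , refl
  Path-split (r ◅ p) (there m∈) with Path-split p m∈
  ... | ps , qs , p₁ , p₂ , refl = _ ∷ ps , qs , r ◅ p₁ , p₂ , refl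

module _ {n : ℕ} (G : MixedGraph n) where

  UAdj-sym : ∀ {i j} → UAdj G i j → UAdj G j i
  UAdj-sym (inj₁ e) = inj₂ e
  UAdj-sym (inj₂ e) = inj₁ e

  UAdj⇒≢ : ∀ {i j} → UAdj G i j → i ≢ j
  UAdj⇒≢ {i} (inj₁ e) refl with trans (sym e) (loopless G i)
  ... | ()
  UAdj⇒≢ {i} (inj₂ e) refl with trans (sym e) (loopless G i)
  ... | ()

  UAdj? : ∀ i j → Dec (UAdj G i j)
  UAdj? i j with adj G i j | adj G j i
  ... | true  | _     = yes (inj₁ refl)
  ... | false | true  = yes (inj₂ refl)
  ... | false | false = no λ { (inj₁ ()) ; (inj₂ ()) }

  UAdj⇒Edge : ∀ {i j} → UAdj G i j → ¬ Arc G i j → ¬ Arc G j i → Edge G i j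
  UAdj⇒Edge {i} {j} e ¬ij ¬ji with adj G i j | adj G j i
  ... | true  | true  = refl , refl
  ... | true  | false = contradiction (refl , refl) ¬ij
  ... | false | true  = contradiction (refl , refl) ¬ji
  ... | false | false with e
  ...   | inj₁ ()
  ...   | inj₂ ()

  Reach-one : ∀ {i j} → UAdj G i j → Reach G i j
  Reach-one e = step e here

  Reach-trans : ∀ {i j k} → Reach G i j → Reach G j k → Reach G i k
  Reach-trans here       r′ = r′
  Reach-trans (step e r) r′ = step e (Reach-trans r r′)

  Reach-sym : ∀ {i j} → Reach G i j → Reach G j i
  Reach-sym here       = here
  Reach-sym (step e r) = Reach-trans (Reach-sym r) (Reach-one (UAdj-sym e))

  Reach⇒neighbour : ∀ {i j} → Reach G i j → i ≢ j → Σ (Fin n) (UAdj G i)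
  Reach⇒neighbour here       i≢i = contradiction refl i≢i
  Reach⇒neighbour (step e _) _   = _ , e

  closed-path⇒¬Acyclic : ∀ {v ws} → Path (UAdj G) v v (ws ++ [ v ]) → Unique (v ∷ ws) →
                         2 ≤ length ws → ¬ Acyclic G
  closed-path⇒¬Acyclic {v} {ws} p u l acyclic = acyclic (v , ws , l , u , Path⇒Linked p)

  IsCycle-rotate : ∀ {v ws u} → IsCycle G v ws → u ∈ v ∷ ws →
                   Σ (List (Fin n)) (IsCycle G u)
  IsCycle-rotate {ws = ws} c (here refl) = ws , c
  IsCycle-rotate {v} {u = u} (l , uniq , linked) (there u∈ws) with ∈-∃++ u∈ws
  ... | ps , qs , refl = qs ++ v ∷ ps , l′ , uniq′ , linked′
    where
    l′ : 2 ≤ length (qs ++ v ∷ ps)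
    l′ = subst (2 ≤_) (length-rotate ps qs u v) l
    uniq′ : Unique (u ∷ qs ++ v ∷ ps)
    uniq′ with Unique-++⁻ (v ∷ ps) uniq
    ... | u₁ , u₂ , disjoint = Unique.++⁺ u₂ u₁ λ (x∈₂ , x∈₁) → disjoint (x∈₁ , x∈₂)
    linked′ : Linked (UAdj G) (u ∷ (qs ++ v ∷ ps) ++ [ u ])
    linked′ with Linked-split (v ∷ ps) u (qs ++ [ v ])
                   (subst (λ t → Linked (UAdj G) (v ∷ t)) (++-assoc ps (u ∷ qs) [ v ]) linked)
    ... | l₁ , l₂ = subst (λ t → Linked (UAdj G) (u ∷ t)) (sym (++-assoc qs (v ∷ ps) [ u ]))
                      (Linked-join (u ∷ qs) v (ps ++ [ u ]) l₂ l₁)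

  leaf∉cycle : ∀ {b c} → (∀ y → UAdj G b y → y ≡ c) → ∀ {v ws} → IsCycle G v ws → b ∉ v ∷ ws
  leaf∉cycle {b} only-c cycle b∈ with IsCycle-rotate cycle b∈
  ... | [] , () , _
  ... | w ∷ [] , s≤s () , _
  ... | w ∷ z ∷ zs , _ , uniq , linked with Linked-∷ʳ⇒Path b w (z ∷ zs) b linked
  ...   | bw , y , _ ◅ p , yb = Unique.Unique[x∷xs]⇒x∉xs (Unique-tail uniq)
                                 (subst (_∈ z ∷ zs) y≡w (last∈ p))
    where
    y≡w : y ≡ w
    y≡w = trans (only-c y (UAdj-sym yb)) (sym (only-c w bw))

  Acyclic⇒¬triangle : Acyclic G → ∀ {a b y} → UAdj G a b → UAdj G b y → UAdj G y a → ⊥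
  Acyclic⇒¬triangle acyclic ab by ya = closed-path⇒¬Acyclic
    (ab ◅ by ◅ ya ◅ end)
    ((UAdj⇒≢ ab ∷ UAdj⇒≢ (UAdj-sym ya) ∷ []) ∷ (UAdj⇒≢ by ∷ []) ∷ [] ∷ [])
    (s≤s (s≤s z≤n)) acyclic

  Acyclic⇒common-neighbour-unique : Acyclic G → ∀ {a b x y} → a ≢ b →
    UAdj G a x → UAdj G x b → UAdj G a y → UAdj G y b → x ≡ y
  Acyclic⇒common-neighbour-unique acyclic {a} {b} {x} {y} a≢b ax xb ay yb with x ≟ y
  ... | yes x≡y = x≡y
  ... | no x≢y  = contradiction acyclic (closed-path⇒¬Acyclic
    (ax ◅ xb ◅ UAdj-sym yb ◅ UAdj-sym ay ◅ end)
    ((UAdj⇒≢ ax ∷ a≢b ∷ UAdj⇒≢ ay ∷ [])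
      ∷ (UAdj⇒≢ xb ∷ x≢y ∷ []) ∷ (UAdj⇒≢ (UAdj-sym yb) ∷ []) ∷ [] ∷ [])
    (s≤s (s≤s z≤n)))

module Kelmans {n} (T : MixedGraph n) {a b : Fin n} (a≢b : a ≢ b) where

  open DecMembership (_≟_ {n}) using (_∈?_)

  private
    A = adj T
    T′ = kelmans T a b
    K = adj T′
    b≢a : b ≢ a
    b≢a = a≢b ∘ sym

  Off : Fin n → Set
  Off i = i ≢ a × i ≢ b

  kelmans-off : ∀ {i j} → Off i → Off j → K i j ≡ A i j
  kelmans-off {i} {j} (i≢a , i≢b) (j≢a , j≢b)
    rewrite isYes-false (i ≟ a) i≢a | isYes-false (i ≟ b) i≢b
          | isYes-false (j ≟ a) j≢a | isYes-false (j ≟ b) j≢b = refl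

  kelmans-into-a : ∀ {i} → Off i → K i a ≡ (A i a ∨ A i b)
  kelmans-into-a {i} (i≢a , i≢b)
    rewrite isYes-false (i ≟ a) i≢a | isYes-false (i ≟ b) i≢b | isYes-true (a ≟ a) refl = refl

  kelmans-into-b : ∀ {i} → Off i → K i b ≡ (A i a ∧ A i b)
  kelmans-into-b {i} (i≢a , i≢b)
    rewrite isYes-false (i ≟ a) i≢a | isYes-false (i ≟ b) i≢b
          | isYes-true (b ≟ b) refl | isYes-false (b ≟ a) b≢a = refl

  kelmans-from-a : ∀ {j} → Off j → K a j ≡ (A a j ∨ A b j)
  kelmans-from-a {j} (j≢a , j≢b)
    rewrite isYes-false (j ≟ a) j≢a | isYes-false (j ≟ b) j≢b | isYes-true (a ≟ a) refl = refl

  kelmans-from-b : ∀ {j} → Off j → K b j ≡ (A a j ∧ A b j)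
  kelmans-from-b {j} (j≢a , j≢b)
    rewrite isYes-false (j ≟ a) j≢a | isYes-false (j ≟ b) j≢b
          | isYes-true (b ≟ b) refl | isYes-false (b ≟ a) b≢a = refl

  kelmans-ab : K a b ≡ A a b
  kelmans-ab rewrite isYes-true (a ≟ a) refl | isYes-true (b ≟ b) refl
                   | isYes-false (b ≟ a) b≢a | isYes-false (a ≟ b) a≢b = refl

  kelmans-ba : K b a ≡ A b a
  kelmans-ba rewrite isYes-true (a ≟ a) refl | isYes-true (b ≟ b) refl
                   | isYes-false (b ≟ a) b≢a | isYes-false (a ≟ b) a≢b = refl

  row-ones-off : ∀ {i} → Off i → row-ones K i ≡ row-ones A i
  row-ones-off {i} oi = ∑-agree-off₂ _ _ a≢b
    (λ j j≢a j≢b → cong ones (kelmans-off oi (j≢a , j≢b)))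
    (subst₂ (λ x y → ones x + ones y ≡ ones (A i a) + ones (A i b))
      (sym (kelmans-into-a oi)) (sym (kelmans-into-b oi)) (ones-∨-∧ (A i a) (A i b)))

  row-ones-ab : row-ones K a + row-ones K b ≡ row-ones A a + row-ones A b
  row-ones-ab = begin
    row-ones K a + row-ones K b              ≡⟨ ∑-distrib-+ (ones ∘ K a) (ones ∘ K b) ⟨
    ∑ (λ j → ones (K a j) + ones (K b j))    ≡⟨ sum-cong-≗ (λ j → column (j ≟ a) (j ≟ b)) ⟩
    ∑ (λ j → ones (A a j) + ones (A b j))    ≡⟨ ∑-distrib-+ (ones ∘ A a) (ones ∘ A b) ⟩
    row-ones A a + row-ones A b              ∎
    where
    open ≡-Reasoning
    column : ∀ {j} → Dec (j ≡ a) → Dec (j ≡ b) →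
             ones (K a j) + ones (K b j) ≡ ones (A a j) + ones (A b j)
    column (yes refl) _ = cong₂ (λ x y → ones x + ones y)
      (trans (loopless T′ a) (sym (loopless T a))) kelmans-ba
    column (no _) (yes refl) = cong₂ (λ x y → ones x + ones y)
      kelmans-ab (trans (loopless T′ b) (sym (loopless T b)))
    column {j} (no j≢a) (no j≢b) = subst₂ (λ x y → ones x + ones y ≡ ones (A a j) + ones (A b j))
      (sym (kelmans-from-a (j≢a , j≢b))) (sym (kelmans-from-b (j≢a , j≢b))) (ones-∨-∧ (A a j) (A b j))

  size-kelmans : size T′ ≡ size T
  size-kelmans = begin
    size T′             ≡⟨ size≡∑row-ones T′ ⟩
    ∑ (row-ones K)      ≡⟨ ∑-agree-off₂ (row-ones K) (row-ones A) a≢b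
                             (λ i i≢a i≢b → row-ones-off (i≢a , i≢b)) row-ones-ab ⟩
    ∑ (row-ones A)      ≡⟨ size≡∑row-ones T ⟨
    size T              ∎
    where open ≡-Reasoning

  SameSide : Fin n → Set
  SameSide i = (A a i ≡ true × A b i ≡ true) ⊎ (A i a ≡ true × A i b ≡ true)

  Condition : Fin n → Set
  Condition x = Edge T a x ⊎ Edge T x b ⊎ (Arc T a x × Arc T b x) ⊎ (Arc T x a × Arc T x b)

  Criterion : Set
  Criterion = Edge T a b ⊎ (¬ UAdj T a b × Σ (Fin n) λ x → UAdj T a x × UAdj T x b × Condition x)

  UAdj-off⁺ : ∀ {i j} → Off i → Off j → UAdj T i j → UAdj T′ i j
  UAdj-off⁺ oi oj (inj₁ e) = inj₁ (trans (kelmans-off oi oj) e)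
  UAdj-off⁺ oi oj (inj₂ e) = inj₂ (trans (kelmans-off oj oi) e)

  UAdj-off⁻ : ∀ {i j} → Off i → Off j → UAdj T′ i j → UAdj T i j
  UAdj-off⁻ oi oj (inj₁ e) = inj₁ (trans (sym (kelmans-off oi oj)) e)
  UAdj-off⁻ oi oj (inj₂ e) = inj₂ (trans (sym (kelmans-off oj oi)) e)

  UAdj-into-a⁺ : ∀ {i} → Off i → UAdj T i a ⊎ UAdj T i b → UAdj T′ i a
  UAdj-into-a⁺ oi (inj₁ (inj₁ e)) = inj₁ (trans (kelmans-into-a oi) (∨≡true⁺ (inj₁ e)))
  UAdj-into-a⁺ oi (inj₂ (inj₁ e)) = inj₁ (trans (kelmans-into-a oi) (∨≡true⁺ (inj₂ e)))
  UAdj-into-a⁺ oi (inj₁ (inj₂ e)) = inj₂ (trans (kelmans-from-a oi) (∨≡true⁺ (inj₁ e)))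
  UAdj-into-a⁺ oi (inj₂ (inj₂ e)) = inj₂ (trans (kelmans-from-a oi) (∨≡true⁺ (inj₂ e)))

  UAdj-into-a⁻ : ∀ {i} → Off i → UAdj T′ i a → UAdj T i a ⊎ UAdj T i b
  UAdj-into-a⁻ oi (inj₁ e) with ∨≡true⁻ (trans (sym (kelmans-into-a oi)) e)
  ... | inj₁ ia = inj₁ (inj₁ ia)
  ... | inj₂ ib = inj₂ (inj₁ ib)
  UAdj-into-a⁻ oi (inj₂ e) with ∨≡true⁻ (trans (sym (kelmans-from-a oi)) e)
  ... | inj₁ ai = inj₁ (inj₂ ai)
  ... | inj₂ bi = inj₂ (inj₂ bi)

  UAdj-into-b⁺ : ∀ {i} → Off i → SameSide i → UAdj T′ i b
  UAdj-into-b⁺ oi (inj₁ (ai , bi)) = inj₂ (trans (kelmans-from-b oi) (∧≡true⁺ ai bi))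
  UAdj-into-b⁺ oi (inj₂ (ia , ib)) = inj₁ (trans (kelmans-into-b oi) (∧≡true⁺ ia ib))

  UAdj-into-b⁻ : ∀ {i} → Off i → UAdj T′ i b → SameSide i
  UAdj-into-b⁻ oi (inj₁ e) = inj₂ (∧≡true⁻ (trans (sym (kelmans-into-b oi)) e))
  UAdj-into-b⁻ oi (inj₂ e) = inj₁ (∧≡true⁻ (trans (sym (kelmans-from-b oi)) e))

  UAdj-ab⁺ : UAdj T a b → UAdj T′ a b
  UAdj-ab⁺ (inj₁ e) = inj₁ (trans kelmans-ab e)
  UAdj-ab⁺ (inj₂ e) = inj₂ (trans kelmans-ba e)

  UAdj-ab⁻ : UAdj T′ a b → UAdj T a b
  UAdj-ab⁻ (inj₁ e) = inj₁ (trans (sym kelmans-ab) e)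
  UAdj-ab⁻ (inj₂ e) = inj₂ (trans (sym kelmans-ba) e)

  SameSide⇒Condition : ∀ {x} → SameSide x → Condition x
  SameSide⇒Condition {x} (inj₁ (ax , bx)) with A x a | A x b
  ... | true  | _     = inj₁ (ax , refl)
  ... | false | true  = inj₂ (inj₁ (refl , bx))
  ... | false | false = inj₂ (inj₂ (inj₁ ((ax , refl) , (bx , refl))))
  SameSide⇒Condition {x} (inj₂ (xa , xb)) with A a x | A b x
  ... | true  | _     = inj₁ (refl , xa)
  ... | false | true  = inj₂ (inj₁ (xb , refl))
  ... | false | false = inj₂ (inj₂ (inj₂ ((xa , refl) , (xb , refl))))

  Condition⇒SameSide : ∀ {x} → UAdj T a x → UAdj T x b → Condition x → SameSide x
  Condition⇒SameSide ax          (inj₁ xb) (inj₁ (_ , xa))                   = inj₂ (xa , xb)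
  Condition⇒SameSide ax          (inj₂ bx) (inj₁ (ax′ , _))                  = inj₁ (ax′ , bx)
  Condition⇒SameSide (inj₁ ax)   xb        (inj₂ (inj₁ (_ , bx)))            = inj₁ (ax , bx)
  Condition⇒SameSide (inj₂ xa)   xb        (inj₂ (inj₁ (xb′ , _)))           = inj₂ (xa , xb′)
  Condition⇒SameSide _           _         (inj₂ (inj₂ (inj₁ ((ax , _) , (bx , _))))) = inj₁ (ax , bx)
  Condition⇒SameSide _           _         (inj₂ (inj₂ (inj₂ ((xa , _) , (xb , _))))) = inj₂ (xa , xb)

  SameSide⇒UAdj : ∀ {x} → SameSide x → UAdj T a x × UAdj T x b
  SameSide⇒UAdj (inj₁ (ax , bx)) = inj₁ ax , inj₂ bx
  SameSide⇒UAdj (inj₂ (xa , xb)) = inj₂ xa , inj₁ xb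

  connected⇒Criterion : ¬ Arc T a b → ¬ Arc T b a → Connected T′ → Criterion
  connected⇒Criterion ¬ab ¬ba connected with UAdj? T a b
  ... | yes ab = inj₁ (UAdj⇒Edge T ab ¬ab ¬ba)
  ... | no ¬ab′ with Reach⇒neighbour T′ {b} {a} (connected b a) (a≢b ∘ sym)
  ...   | k , bk = inj₂ (¬ab′ , k , ak , kb , SameSide⇒Condition same)
    where
    k≢a : k ≢ a
    k≢a refl = ¬ab′ (UAdj-ab⁻ (UAdj-sym T′ {b} {a} bk))
    same : SameSide k
    same = UAdj-into-b⁻ (k≢a , UAdj⇒≢ T′ {b} {k} bk ∘ sym) (UAdj-sym T′ {b} {k} bk)
    ak : UAdj T a k
    ak = proj₁ (SameSide⇒UAdj same)
    kb : UAdj T k b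
    kb = proj₂ (SameSide⇒UAdj same)

  data Place : Fin n → Set where
    at-a : Place a
    at-b : Place b
    off  : ∀ {i} → Off i → Place i

  place : ∀ i → Place i
  place i with i ≟ a | i ≟ b
  ... | yes refl | _        = at-a
  ... | no _     | yes refl = at-b
  ... | no i≢a   | no i≢b   = off (i≢a , i≢b)

  member-Off : ∀ {l z} → a ∉ l → b ∉ l → z ∈ l → Off z
  member-Off a∉ b∉ z∈ = (λ { refl → a∉ z∈ }) , (λ { refl → b∉ z∈ })

  hub : Criterion → Fin n
  hub (inj₁ _)            = a
  hub (inj₂ (_ , x , _)) = x

  bridge : Criterion → Reach T′ a b
  bridge (inj₁ (ab , _)) = Reach-one T′ (UAdj-ab⁺ (inj₁ ab))
  bridge (inj₂ (_ , x , ax , xb , condition)) =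
    step (UAdj-sym T′ {x} {a} (UAdj-into-a⁺ ox (inj₁ (UAdj-sym T ax))))
         (Reach-one T′ (UAdj-into-b⁺ ox (Condition⇒SameSide ax xb condition)))
    where
    ox : Off x
    ox = UAdj⇒≢ T ax ∘ sym , UAdj⇒≢ T xb

  b-leaf : Acyclic T → (criterion : Criterion) → ∀ y → UAdj T′ b y → y ≡ hub criterion
  b-leaf acyclic criterion y by with place y | criterion
  ... | at-a   | inj₁ _             = refl
  ... | at-a   | inj₂ (¬ab , _)     = contradiction (UAdj-ab⁻ (UAdj-sym T′ {b} {a} by)) ¬ab
  ... | at-b   | _                  = contradiction refl (UAdj⇒≢ T′ {b} {b} by)
  ... | off oy | inj₁ (ab , _)      =
    let ay , yb = SameSide⇒UAdj (UAdj-into-b⁻ oy (UAdj-sym T′ {b} {y} by))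
    in ⊥-elim (Acyclic⇒¬triangle T acyclic (inj₁ ab) (UAdj-sym T yb) (UAdj-sym T ay))
  ... | off oy | inj₂ (_ , x , ax , xb , _) =
    let ay , yb = SameSide⇒UAdj (UAdj-into-b⁻ oy (UAdj-sym T′ {b} {y} by))
    in sym (Acyclic⇒common-neighbour-unique T acyclic a≢b ax xb ay yb)

  module _ (criterion : Criterion) where

    reach-a : ∀ {u} → Place u → UAdj T u a ⊎ UAdj T u b → Reach T′ u a
    reach-a at-a     _ = here
    reach-a at-b     _ = Reach-sym T′ (bridge criterion)
    reach-a (off ou) e = Reach-one T′ (UAdj-into-a⁺ ou e)

    UAdj⇒Reach : ∀ {u v} → UAdj T u v → Reach T′ u v
    UAdj⇒Reach {u} {v} e with place u | place v
    ... | pu     | at-a   = reach-a pu (inj₁ e)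
    ... | pu     | at-b   = Reach-trans T′ (reach-a pu (inj₂ e)) (bridge criterion)
    ... | at-a   | off ov = Reach-sym T′ (reach-a (off ov) (inj₁ (UAdj-sym T e)))
    ... | at-b   | off ov = Reach-trans T′ (Reach-sym T′ (bridge criterion))
                                        (Reach-sym T′ (reach-a (off ov) (inj₂ (UAdj-sym T e))))
    ... | off ou | off ov = Reach-one T′ (UAdj-off⁺ ou ov e)

    Reach⇒Reach′ : ∀ {u v} → Reach T u v → Reach T′ u v
    Reach⇒Reach′ here       = here
    Reach⇒Reach′ (step e r) = Reach-trans T′ (UAdj⇒Reach e) (Reach⇒Reach′ r)

  Attached : Fin n → Set
  Attached u = UAdj T u a ⊎ (¬ UAdj T u a × UAdj T u b)

  attached : ∀ {u} → Off u → UAdj T′ u a → Attached u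
  attached {u} ou e with UAdj? T u a
  ... | yes ua = inj₁ ua
  ... | no ¬ua with UAdj-into-a⁻ ou e
  ...   | inj₁ ua = contradiction ua ¬ua
  ...   | inj₂ ub = inj₂ (¬ua , ub)

  -- w ∷ z ∷ zs are the vertices other than a of a cycle of T′ through a, joined in T by P.
  module Surgery (acyclic : Acyclic T) {w y z zs} (P : Path (UAdj T) w y (z ∷ zs))
                 (uniq : Unique (w ∷ z ∷ zs)) (a∉ : a ∉ w ∷ z ∷ zs) (b∉ : b ∉ w ∷ z ∷ zs) where

    same-end : ∀ {c} → c ∉ w ∷ z ∷ zs → UAdj T w c → UAdj T y c → ⊥
    same-end c∉ wc yc = closed-path⇒¬Acyclic T (UAdj-sym T wc ◅ (P ▻ yc))
      (Unique-∷⁺ c∉ uniq) (s≤s (s≤s z≤n)) acyclic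

    cross-edge : ∀ {c d} → c ≢ d → c ∉ w ∷ z ∷ zs → d ∉ w ∷ z ∷ zs →
                 UAdj T c d → UAdj T c w → UAdj T y d → ⊥
    cross-edge c≢d c∉ d∉ cd cw yd = closed-path⇒¬Acyclic T ((cw ◅ (P ▻ yd)) ▻ UAdj-sym T cd)
      (Unique-∷⁺ (∉-∷ʳ⁺ (w ∷ z ∷ zs) c∉ c≢d) (Unique-∷ʳ⁺ uniq d∉)) (s≤s (s≤s z≤n)) acyclic

    cross-two : ∀ {c d x} → c ∉ w ∷ z ∷ zs → d ∉ w ∷ z ∷ zs → x ∉ w ∷ z ∷ zs →
                UAdj T c w → UAdj T y d → UAdj T d x → UAdj T x c → c ≢ d → ⊥
    cross-two {c} {d} {x} c∉ d∉ x∉ cw yd dx xc c≢d = closed-path⇒¬Acyclic T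
      (((cw ◅ (P ▻ yd)) ▻ dx) ▻ xc)
      (Unique-∷⁺ (∉-∷ʳ⁺ (w ∷ z ∷ zs ++ [ d ]) (∉-∷ʳ⁺ (w ∷ z ∷ zs) c∉ c≢d) (UAdj⇒≢ T xc ∘ sym))
                 (Unique-∷ʳ⁺ (Unique-∷ʳ⁺ uniq d∉) (∉-∷ʳ⁺ (w ∷ z ∷ zs) x∉ (UAdj⇒≢ T dx ∘ sym))))
      (s≤s (s≤s z≤n)) acyclic

    tail-cycle : ∀ {m d} → m ∈ w ∷ z ∷ zs → d ∉ w ∷ z ∷ zs → UAdj T m d → UAdj T y d → m ≢ y → ⊥
    tail-cycle {m} {d} m∈ d∉ md yd m≢y with Path-split P m∈
    ... | ps , [] , P₁ , end , _ = m≢y refl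
    ... | ps , q ∷ qs , P₁ , P₂ , zs≡ = closed-path⇒¬Acyclic T ((P₂ ▻ yd) ▻ UAdj-sym T md)
      (Unique-∷ʳ⁺ (Unique-∷⁺ m∉qs uqs) d∉mqs) (length-∷-∷ʳ q qs d) acyclic
      where
      split-uniq : Unique (w ∷ ps) × Unique (q ∷ qs) × Disjoint (w ∷ ps) (q ∷ qs)
      split-uniq = Unique-++⁻ (w ∷ ps) (subst (λ l → Unique (w ∷ l)) zs≡ uniq)
      uqs : Unique (q ∷ qs)
      uqs = proj₁ (proj₂ split-uniq)
      m∉qs : m ∉ q ∷ qs
      m∉qs m∈qs = proj₂ (proj₂ split-uniq) (last∈ P₁ , m∈qs)
      d∉mqs : d ∉ m ∷ q ∷ qs
      d∉mqs (here refl)   = d∉ m∈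
      d∉mqs (there d∈qs) = d∉ (subst (λ l → d ∈ w ∷ l) (sym zs≡) (there (∈-++⁺ʳ ps d∈qs)))

    head-cycle : ∀ {m d} → m ∈ w ∷ z ∷ zs → d ∉ w ∷ z ∷ zs → UAdj T d w → UAdj T m d → m ≢ w → ⊥
    head-cycle {m} {d} m∈ d∉ dw md m≢w with Path-split P m∈
    ... | [] , qs , end , P₂ , _ = m≢w refl
    ... | p ∷ ps , qs , P₁ , P₂ , zs≡ = closed-path⇒¬Acyclic T ((dw ◅ P₁) ▻ md)
      (Unique-∷⁺ d∉wps uniq-wps) (s≤s (s≤s z≤n)) acyclic
      where
      uniq-wps : Unique (w ∷ p ∷ ps)
      uniq-wps = proj₁ (Unique-++⁻ (w ∷ p ∷ ps) (subst (λ l → Unique (w ∷ l)) zs≡ uniq))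
      d∉wps : d ∉ w ∷ p ∷ ps
      d∉wps d∈ = d∉ (subst (λ l → d ∈ w ∷ l) (sym zs≡) (∈-++⁺ˡ d∈))

    surgery : Criterion → Attached w → Attached y → ⊥
    surgery _ (inj₁ wa) (inj₁ ya) = same-end a∉ wa ya
    surgery _ (inj₂ (_ , wb)) (inj₂ (_ , yb)) = same-end b∉ wb yb
    surgery (inj₁ (ab , _)) (inj₁ wa) (inj₂ (_ , yb)) =
      cross-edge a≢b a∉ b∉ (inj₁ ab) (UAdj-sym T wa) yb
    surgery (inj₁ (ab , _)) (inj₂ (_ , wb)) (inj₁ ya) =
      cross-edge (a≢b ∘ sym) b∉ a∉ (inj₂ ab) (UAdj-sym T wb) ya
    surgery (inj₂ (_ , x , ax , xb , _)) (inj₁ wa) (inj₂ (¬ya , yb)) with x ∈? w ∷ z ∷ zs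
    ... | no x∉  = cross-two a∉ b∉ x∉ (UAdj-sym T wa) yb (UAdj-sym T xb) (UAdj-sym T ax) a≢b
    ... | yes x∈ = tail-cycle x∈ b∉ xb yb λ { refl → ¬ya (UAdj-sym T ax) }
    surgery (inj₂ (_ , x , ax , xb , _)) (inj₂ (¬wa , wb)) (inj₁ ya) with x ∈? w ∷ z ∷ zs
    ... | no x∉  = cross-two b∉ a∉ x∉ (UAdj-sym T wb) ya ax xb (a≢b ∘ sym)
    ... | yes x∈ = head-cycle x∈ b∉ (UAdj-sym T wb) xb λ { refl → ¬wa (UAdj-sym T ax) }

  acyclic′ : Acyclic T → Criterion → Acyclic T′
  acyclic′ acyclic criterion (v , ws , cycle@(l , uniq , linked)) with a ∈? v ∷ ws
  ... | no a∉ = acyclic (v , ws , l , uniq ,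
      Linked-mapᴾ UAdj-off⁻ (All.tabulate (member-Off a∉ b∉ ∘ ∈-cycle)) linked)
    where
    b∉ : b ∉ v ∷ ws
    b∉ = leaf∉cycle T′ (b-leaf acyclic criterion) cycle
    ∈-cycle : ∀ {u} → u ∈ v ∷ ws ++ [ v ] → u ∈ v ∷ ws
    ∈-cycle u∈ with ∈-∷ʳ⁻ (v ∷ ws) u∈
    ... | inj₁ u∈′ = u∈′
    ... | inj₂ refl = here refl
  ... | yes a∈ with IsCycle-rotate T′ cycle a∈
  ...   | []         , () , _
  ...   | w ∷ []     , s≤s () , _
  ...   | w ∷ z ∷ zs , cycle′@(_ , uniq′ , linked′) with Linked-∷ʳ⇒Path a w (z ∷ zs) a linked′
  ...     | aw , y , P′ , ya =
    Surgery.surgery acyclic (Path-mapᴾ UAdj-off⁻ (All.tabulate off-W) P′) (Unique-tail uniq′)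
      a∉ b∉ criterion (attached (off-W (here refl)) (UAdj-sym T′ {a} {w} aw)) (attached (off-W (last∈ P′)) ya)
    where
    a∉ : a ∉ w ∷ z ∷ zs
    a∉ = Unique.Unique[x∷xs]⇒x∉xs uniq′
    b∉ : b ∉ w ∷ z ∷ zs
    b∉ = leaf∉cycle T′ (b-leaf acyclic criterion) cycle′ ∘ there
    off-W : ∀ {u} → u ∈ w ∷ z ∷ zs → Off u
    off-W = member-Off a∉ b∉

  kelmans-tree⇔Criterion : IsMixedTree T → ¬ Arc T a b → ¬ Arc T b a → IsMixedTree T′ ⇔ Criterion
  kelmans-tree⇔Criterion (connected , acyclic) ¬ab ¬ba = mk⇔
    (λ (connected′ , _) → connected⇒Criterion ¬ab ¬ba connected′)
    (λ criterion → (λ i j → Reach⇒Reach′ criterion (connected i j)) , acyclic′ acyclic criterion)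

lemma4p1 : (n m : ℕ) (T : MixedGraph n) → IsMixedTree T → size T ≡ m →
    (a b : Fin n) → ¬ (a ≡ b) → ¬ Arc T a b → ¬ Arc T b a →
    (IsMixedTree (kelmans T a b) × size (kelmans T a b) ≡ m)
    ⇔ (Edge T a b
       ⊎ (¬ UAdj T a b × Σ (Fin n) λ x → UAdj T a x × UAdj T x b ×
           (Edge T a x ⊎ Edge T x b ⊎ (Arc T a x × Arc T b x) ⊎ (Arc T x a × Arc T x b))))
lemma4p1 n m T tree size≡m a b a≢b ¬ab ¬ba = mk⇔
  (λ (tree′ , _) → to tree′)
  (λ criterion → from criterion , trans (Kelmans.size-kelmans T a≢b) size≡m)
  where open Equivalence (Kelmans.kelmans-tree⇔Criterion T a≢b tree ¬ab ¬ba)
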